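{- Let $P\colon\mathcal{C}^{op}\to\mathbf{DLat}$ be a $\{\land,\lor\}$-doctrine with existential completion $P^\exists$ as described in the context. The left adjoints $\Sigma_d$ ($d\in\mathcal{C}$) satisfy the Frobenius condition: for all $c,d$, $X\in P^\exists(d\times c)$ and $Y\in P^\exists(c)$, $\Sigma_d(X)\land Y=\Sigma_d(X\land{\pi_d^\exists}^\ast Y)$; and the Beck–Chevalley condition: for every arrow $f\colon c'\to c$ and every $d$, ${f^\exists}^\ast\circ\Sigma_d=\Sigma'_d\circ{(1_d\times f)^\exists}^\ast$ as maps $P^\exists(d\times c)\to P^\exists(c')$, where $\Sigma'_d\colon P^\exists(d\times c')\to P^\exists(c')$.
   Context: A $\{\land,\lor\}$-doctrine is a functor $P\colon\mathcal{C}^{op}\to\mathbf{DLat}$ ($\mathcal{C}$ with finite products); $f^\ast=P(f)$; $\pi_d\colon d\times c\to c$ is the projection forgetting $d$. $P^\exists(c)$ is the posetal reflection of the preorder of finite sets $\{(d_1,x_1),\dots,(d_n,x_n)\}$ ($d_i\in\mathcal{C}$, $x_i\in P(d_i\times c)$) with $\{(d_i,x_i)\}_{i\le n}\le\{(e_j,y_j)\}_{j\le m}$ iff for each $i$ there are arrows $r_\ell\colon d_i\times c\to e_{j_\ell}\times c$ ($\ell=1,\dots,k$, $j_\ell\le m$) with $\pi_{e_{j_\ell}}\circ r_\ell=\pi_{d_i}$ and $x_i\le r_1^\ast y_{j_1}\lor\dots\lor r_k^\ast y_{j_k}$; it is a distributive lattice. For $f\colon c'\to c$, ${f^\exists}^\ast$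 sends $\{(d_i,x_i)\}$ to $\{(d_i,(1_{d_i}\times f)^\ast x_i)\}$. $\Sigma_d\colon P^\exists(d\times c)\to P^\exists(c)$ sends $\{(e_i,x_i)\}_{i\le n}$ (with $x_i\in P(e_i\times d\times c)$) to $\{(e_i\times d,x_i)\}_{i\le n}$; it is left adjoint to ${\pi_d^\exists}^\ast$. -}

module Defs where

open import Level using (Level; _⊔_) renaming (suc to lsuc)
open import Data.Product using (Σ; _,_; proj₁; proj₂; _×_)
open import Data.List using (List; []; _∷_; map; foldr; length; lookup; concatMap)
open import Data.List.Relation.Unary.All using (All)
open import Data.Fin using (Fin)
open import Relation.Binary.PropositionalEquality using (_≡_)
open import Algebra.Lattice.Bundles using (DistributiveLattice)

record CartesianCategory (o h : Level) : Set (lsuc (o ⊔ h)) where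
  infixr 9 _∘_
  infixr 7 _⊗_
  field
    Obj  : Set o
    Hom  : Obj → Obj → Set h
    id   : ∀ {a} → Hom a a
    _∘_  : ∀ {a b c} → Hom b c → Hom a b → Hom a c
    identityˡ : ∀ {a b} (f : Hom a b) → id ∘ f ≡ f
    identityʳ : ∀ {a b} (f : Hom a b) → f ∘ id ≡ f
    assoc : ∀ {a b c d} (f : Hom c d) (g : Hom b c) (k : Hom a b) →
            (f ∘ g) ∘ k ≡ f ∘ (g ∘ k)
    𝟙    : Obj
    !    : ∀ {a} → Hom a 𝟙
    !-unique : ∀ {a} (f : Hom a 𝟙) → f ≡ !
    _⊗_  : Obj → Obj → Obj
    π₁   : ∀ {a b} → Hom (a ⊗ b) a
    π₂   : ∀ {a b} → Hom (a ⊗ b) b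
    ⟨_,_⟩ : ∀ {x a b} → Hom x a → Hom x b → Hom x (a ⊗ b)
    π₁-β : ∀ {x a b} (f : Hom x a) (g : Hom x b) → π₁ ∘ ⟨ f , g ⟩ ≡ f
    π₂-β : ∀ {x a b} (f : Hom x a) (g : Hom x b) → π₂ ∘ ⟨ f , g ⟩ ≡ g
    ⟨⟩-η : ∀ {x a b} (k : Hom x (a ⊗ b)) → ⟨ π₁ ∘ k , π₂ ∘ k ⟩ ≡ k

  _⊗₁_ : ∀ {a b a' b'} → Hom a a' → Hom b b' → Hom (a ⊗ b) (a' ⊗ b')
  f ⊗₁ g = ⟨ f ∘ π₁ , g ∘ π₂ ⟩

  assocʳ : ∀ {e d c} → Hom ((e ⊗ d) ⊗ c) (e ⊗ (d ⊗ c))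
  assocʳ = ⟨ π₁ ∘ π₁ , ⟨ π₂ ∘ π₁ , π₂ ⟩ ⟩

record BDLat (c ℓ : Level) : Set (lsuc (c ⊔ ℓ)) where
  field
    distributiveLattice : DistributiveLattice c ℓ
  open DistributiveLattice distributiveLattice public
  field
    ⊤ : Carrier
    ⊥ : Carrier
    ∧-identityʳ : ∀ x → (x ∧ ⊤) ≈ x
    ∨-identityʳ : ∀ x → (x ∨ ⊥) ≈ x

  _≤_ : Carrier → Carrier → Set ℓ
  x ≤ y = (x ∧ y) ≈ x

  ⋁ : List Carrier → Carrier
  ⋁ = foldr _∨_ ⊥

record Doctrine (o h c ℓ : Level) : Set (lsuc (o ⊔ h ⊔ c ⊔ ℓ)) where
  field
    𝒞 : CartesianCategory o h
  open CartesianCategory 𝒞 public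
  field
    P : Obj → BDLat c ℓ
  open module L (a : Obj) = BDLat (P a) public
    using () renaming (Carrier to ∣P∣)
  module PL (a : Obj) = BDLat (P a)
  field
    _* : ∀ {a b} → Hom a b → ∣P∣ b → ∣P∣ a
    *-cong : ∀ {a b} (f : Hom a b) {x y : ∣P∣ b} →
             PL._≈_ b x y → PL._≈_ a ((f *) x) ((f *) y)
    *-∧ : ∀ {a b} (f : Hom a b) (x y : ∣P∣ b) →
          PL._≈_ a ((f *) (PL._∧_ b x y)) (PL._∧_ a ((f *) x) ((f *) y))
    *-∨ : ∀ {a b} (f : Hom a b) (x y : ∣P∣ b) →
          PL._≈_ a ((f *) (PL._∨_ b x y)) (PL._∨_ a ((f *) x) ((f *) y))
    *-⊤ : ∀ {a b} (f : Hom a b) → PL._≈_ a ((f *) (PL.⊤ b)) (PL.⊤ a)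
    *-⊥ : ∀ {a b} (f : Hom a b) → PL._≈_ a ((f *) (PL.⊥ b)) (PL.⊥ a)
    *-id : ∀ {a} (x : ∣P∣ a) → PL._≈_ a ((id *) x) x
    *-∘  : ∀ {a b c} (g : Hom b c) (f : Hom a b) (x : ∣P∣ c) →
           PL._≈_ a (((g ∘ f) *) x) ((f *) ((g *) x))

module Existential {o h p ℓ} (D : Doctrine o h p ℓ) where
  open Doctrine D

  Gen : Obj → Set (o ⊔ p)
  Gen c = Σ Obj (λ d → ∣P∣ (d ⊗ c))

  -- representatives of elements of P^∃(c): finite lists of generators
  P∃ : Obj → Set (o ⊔ p)
  P∃ c = List (Gen c)

  Piece : ∀ {c} → Obj → P∃ c → Set h
  Piece {c} d Y = Σ (Fin (length Y)) λ j →
    Σ (Hom (d ⊗ c) (proj₁ (lookup Y j) ⊗ c)) λ r → π₂ ∘ r ≡ π₂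

  pieceVal : ∀ {c d} (Y : P∃ c) → Piece d Y → ∣P∣ (d ⊗ c)
  pieceVal Y (j , r , _) = (r *) (proj₂ (lookup Y j))

  _◁_ : ∀ {c} → Gen c → P∃ c → Set (h ⊔ ℓ)
  _◁_ {c} (d , x) Y = Σ (List (Piece d Y)) λ ps →
    PL._≤_ (d ⊗ c) x (PL.⋁ (d ⊗ c) (map (pieceVal Y) ps))

  _≤∃_ : ∀ {c} → P∃ c → P∃ c → Set (o ⊔ h ⊔ p ⊔ ℓ)
  X ≤∃ Y = All (λ g → g ◁ Y) X

  -- equality in the posetal reflection
  _≈∃_ : ∀ {c} → P∃ c → P∃ c → Set (o ⊔ h ⊔ p ⊔ ℓ)
  X ≈∃ Y = (X ≤∃ Y) × (Y ≤∃ X)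

  _∧∃_ : ∀ {c} → P∃ c → P∃ c → P∃ c
  _∧∃_ {c} X Y = concatMap (λ { (d , x) → map (λ { (e , y) →
      ((d ⊗ e) , PL._∧_ ((d ⊗ e) ⊗ c)
                   ((⟨ π₁ ∘ π₁ , π₂ ⟩ *) x)
                   ((⟨ π₂ ∘ π₁ , π₂ ⟩ *) y)) }) Y }) X

  _∨∃_ : ∀ {c} → P∃ c → P∃ c → P∃ c
  X ∨∃ Y = Data.List._++_ X Y

  _∃* : ∀ {c' c} → Hom c' c → P∃ c → P∃ c'
  (f ∃*) X = map (λ { (d , x) → (d , ((id ⊗₁ f) *) x) }) X

  -- Σ_d : P^∃(d × c) → P^∃(c), (e , x) ↦ (e × d , x)
  -- (x ∈ P(e × (d × c)) transported along (e × d) × c ≅ e × (d × c))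
  Σ∃ : ∀ {c} (d : Obj) → P∃ (d ⊗ c) → P∃ c
  Σ∃ d X = map (λ { (e , x) → ((e ⊗ d) , (assocʳ *) x) }) X

{-# OPTIONS --safe #-}
-- Both sides of each equation are lists of generators of the same length, and
-- corresponding generators are reindexings of each other along an isomorphism
-- over c: for Frobenius the exchange ((e × d) × e') × c ≅ ((e × e') × d) × c of
-- the witnesses, for Beck–Chevalley the identity, because assocʳ is natural.
-- Generators related in this way cover each other, so the lists are equal in
-- the posetal reflection.
module Submission where

open import Defs
open import Level using (_⊔_)
open import Data.Product using (Σ; _,_; proj₁; _×_)
open import Data.List using ([]; _∷_; map; _++_)
open import Data.List.Relation.Unary.All as All using (All; []; _∷_)
open import Data.List.Relation.Unary.Any using (Any; here; there; index)
open import Data.List.Relation.Unary.Any.Properties using (lookup-index)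
open import Data.List.Relation.Binary.Pointwise as Pointwise using (Pointwise; []; _∷_)
open import Relation.Binary.PropositionalEquality using (_≡_; refl; sym; trans; cong; cong₂; module ≡-Reasoning)
import Relation.Binary.Reasoning.Setoid as SetoidReasoning

module _ {a b r} {A : Set a} {B : Set b} {R : A → B → Set r} where

  pointwise⇒all-any : ∀ {xs ys} → Pointwise R xs ys → All (λ x → Any (R x) ys) xs
  pointwise⇒all-any []         = []
  pointwise⇒all-any (rxy ∷ rs) = here rxy ∷ All.map there (pointwise⇒all-any rs)

module CartesianProperties {o h} (𝒞 : CartesianCategory o h) where
  open CartesianCategory 𝒞
  open ≡-Reasoning

  ⟨⟩∘ : ∀ {x y a b} {f : Hom x a} {g : Hom x b} (k : Hom y x) →
        ⟨ f , g ⟩ ∘ k ≡ ⟨ f ∘ k , g ∘ k ⟩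
  ⟨⟩∘ {f = f} {g} k = begin
    ⟨ f , g ⟩ ∘ k                                   ≡⟨ sym (⟨⟩-η _) ⟩
    ⟨ π₁ ∘ (⟨ f , g ⟩ ∘ k) , π₂ ∘ (⟨ f , g ⟩ ∘ k) ⟩ ≡⟨ cong₂ ⟨_,_⟩ (sym (assoc _ _ _)) (sym (assoc _ _ _)) ⟩
    ⟨ (π₁ ∘ ⟨ f , g ⟩) ∘ k , (π₂ ∘ ⟨ f , g ⟩) ∘ k ⟩ ≡⟨ cong₂ (λ u v → ⟨ u ∘ k , v ∘ k ⟩) (π₁-β f g) (π₂-β f g) ⟩
    ⟨ f ∘ k , g ∘ k ⟩                               ∎

  ∘π₁-β : ∀ {x a b z} (f : Hom a z) (u : Hom x a) (v : Hom x b) → (f ∘ π₁) ∘ ⟨ u , v ⟩ ≡ f ∘ u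
  ∘π₁-β f u v = trans (assoc f π₁ ⟨ u , v ⟩) (cong (f ∘_) (π₁-β u v))

  ∘π₂-β : ∀ {x a b z} (f : Hom b z) (u : Hom x a) (v : Hom x b) → (f ∘ π₂) ∘ ⟨ u , v ⟩ ≡ f ∘ v
  ∘π₂-β f u v = trans (assoc f π₂ ⟨ u , v ⟩) (cong (f ∘_) (π₂-β u v))

  ⊗₁∘⟨⟩ : ∀ {x a b a' b'} (f : Hom a a') (g : Hom b b') (u : Hom x a) (v : Hom x b) →
          (f ⊗₁ g) ∘ ⟨ u , v ⟩ ≡ ⟨ f ∘ u , g ∘ v ⟩
  ⊗₁∘⟨⟩ f g u v = trans (⟨⟩∘ _) (cong₂ ⟨_,_⟩ (∘π₁-β f u v) (∘π₂-β g u v))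

  assocʳ∘⟨⟩ : ∀ {x e d c} (k : Hom x (e ⊗ d)) (w : Hom x c) →
              assocʳ ∘ ⟨ k , w ⟩ ≡ ⟨ π₁ ∘ k , ⟨ π₂ ∘ k , w ⟩ ⟩
  assocʳ∘⟨⟩ k w = trans (⟨⟩∘ _) (cong₂ ⟨_,_⟩ (∘π₁-β π₁ k w)
                    (trans (⟨⟩∘ _) (cong₂ ⟨_,_⟩ (∘π₁-β π₂ k w) (π₂-β k w))))

  wk₁ : ∀ {a b c} → Hom ((a ⊗ b) ⊗ c) (a ⊗ c)
  wk₁ = ⟨ π₁ ∘ π₁ , π₂ ⟩

  wk₂ : ∀ {a b c} → Hom ((a ⊗ b) ⊗ c) (b ⊗ c)
  wk₂ = ⟨ π₂ ∘ π₁ , π₂ ⟩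

  swap₂₃ : ∀ {a b x c} → Hom (((a ⊗ b) ⊗ x) ⊗ c) (((a ⊗ x) ⊗ b) ⊗ c)
  swap₂₃ = ⟨ ⟨ ⟨ π₁ ∘ (π₁ ∘ π₁) , π₂ ∘ π₁ ⟩ , π₂ ∘ (π₁ ∘ π₁) ⟩ , π₂ ⟩

  wk₁∘⟨⟩ : ∀ {x a b c} (k : Hom x (a ⊗ b)) (w : Hom x c) → wk₁ ∘ ⟨ k , w ⟩ ≡ ⟨ π₁ ∘ k , w ⟩
  wk₁∘⟨⟩ k w = trans (⟨⟩∘ _) (cong₂ ⟨_,_⟩ (∘π₁-β π₁ k w) (π₂-β k w))

  wk₂∘⟨⟩ : ∀ {x a b c} (k : Hom x (a ⊗ b)) (w : Hom x c) → wk₂ ∘ ⟨ k , w ⟩ ≡ ⟨ π₂ ∘ k , w ⟩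
  wk₂∘⟨⟩ k w = trans (⟨⟩∘ _) (cong₂ ⟨_,_⟩ (∘π₁-β π₂ k w) (π₂-β k w))

  ∘π₁∘π₁-β : ∀ {x a b c z} (f : Hom a z) (u : Hom x a) (v : Hom x b) (w : Hom x c) →
             (f ∘ (π₁ ∘ π₁)) ∘ ⟨ ⟨ u , v ⟩ , w ⟩ ≡ f ∘ u
  ∘π₁∘π₁-β f u v w = trans (assoc f _ _) (cong (f ∘_) (trans (∘π₁-β π₁ _ w) (π₁-β u v)))

  ⟨π₁,π₂⟩≡id : ∀ {a b} → ⟨ π₁ , π₂ ⟩ ≡ id {a ⊗ b}
  ⟨π₁,π₂⟩≡id = trans (cong₂ ⟨_,_⟩ (sym (identityʳ π₁)) (sym (identityʳ π₂))) (⟨⟩-η id)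

  swap₂₃∘⟨⟩ : ∀ {y a b x c} (u : Hom y a) (v : Hom y b) (w : Hom y x) (z : Hom y c) →
              swap₂₃ ∘ ⟨ ⟨ ⟨ u , v ⟩ , w ⟩ , z ⟩ ≡ ⟨ ⟨ ⟨ u , w ⟩ , v ⟩ , z ⟩
  swap₂₃∘⟨⟩ {y} {a} {b} {x} {c} u v w z =
    trans (⟨⟩∘ t) (cong₂ ⟨_,_⟩
      (trans (⟨⟩∘ t) (cong₂ ⟨_,_⟩ (trans (⟨⟩∘ t) (cong₂ ⟨_,_⟩ t↦u t↦w)) t↦v))
      (π₂-β _ z))
    where
    t : Hom y (((a ⊗ b) ⊗ x) ⊗ c)
    t = ⟨ ⟨ ⟨ u , v ⟩ , w ⟩ , z ⟩
    t↦u : (π₁ ∘ (π₁ ∘ π₁)) ∘ t ≡ u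
    t↦u = trans (∘π₁∘π₁-β π₁ ⟨ u , v ⟩ w z) (π₁-β u v)
    t↦v : (π₂ ∘ (π₁ ∘ π₁)) ∘ t ≡ v
    t↦v = trans (∘π₁∘π₁-β π₂ ⟨ u , v ⟩ w z) (π₂-β u v)
    t↦w : (π₂ ∘ π₁) ∘ t ≡ w
    t↦w = trans (∘π₁-β π₂ _ z) (π₂-β _ w)

  swap₂₃-involutive : ∀ {a b x c} → swap₂₃ ∘ swap₂₃ ≡ id {((a ⊗ b) ⊗ x) ⊗ c}
  swap₂₃-involutive = begin
    swap₂₃ ∘ swap₂₃                                                    ≡⟨ swap₂₃∘⟨⟩ _ _ _ _ ⟩
    ⟨ ⟨ ⟨ π₁ ∘ (π₁ ∘ π₁) , π₂ ∘ (π₁ ∘ π₁) ⟩ , π₂ ∘ π₁ ⟩ , π₂ ⟩        ≡⟨ cong (λ k → ⟨ ⟨ k , π₂ ∘ π₁ ⟩ , π₂ ⟩) (⟨⟩-η _) ⟩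
    ⟨ ⟨ π₁ ∘ π₁ , π₂ ∘ π₁ ⟩ , π₂ ⟩                                     ≡⟨ cong ⟨_, π₂ ⟩ (⟨⟩-η _) ⟩
    ⟨ π₁ , π₂ ⟩                                                        ≡⟨ ⟨π₁,π₂⟩≡id ⟩
    id                                                                 ∎

  assocʳ∘swap₂₃ : ∀ {e d x c} →
    assocʳ ∘ swap₂₃ {e} {d} {x} {c} ≡ ⟨ ⟨ π₁ ∘ (π₁ ∘ π₁) , π₂ ∘ π₁ ⟩ , ⟨ π₂ ∘ (π₁ ∘ π₁) , π₂ ⟩ ⟩
  assocʳ∘swap₂₃ = trans (assocʳ∘⟨⟩ _ _) (cong₂ (λ u v → ⟨ u , ⟨ v , π₂ ⟩ ⟩) (π₁-β _ _) (π₂-β _ _))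

  assocʳ∘wk₁ : ∀ {e d x c} →
    assocʳ ∘ wk₁ ≡ wk₁ ∘ (assocʳ ∘ swap₂₃ {e} {d} {x} {c})
  assocʳ∘wk₁ = begin
    assocʳ ∘ wk₁                                                       ≡⟨ assocʳ∘⟨⟩ _ _ ⟩
    ⟨ π₁ ∘ (π₁ ∘ π₁) , ⟨ π₂ ∘ (π₁ ∘ π₁) , π₂ ⟩ ⟩                        ≡⟨ cong ⟨_, ⟨ π₂ ∘ (π₁ ∘ π₁) , π₂ ⟩ ⟩ (sym (π₁-β _ _)) ⟩
    ⟨ π₁ ∘ ⟨ π₁ ∘ (π₁ ∘ π₁) , π₂ ∘ π₁ ⟩ , ⟨ π₂ ∘ (π₁ ∘ π₁) , π₂ ⟩ ⟩    ≡⟨ sym (wk₁∘⟨⟩ _ _) ⟩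
    wk₁ ∘ ⟨ ⟨ π₁ ∘ (π₁ ∘ π₁) , π₂ ∘ π₁ ⟩ , ⟨ π₂ ∘ (π₁ ∘ π₁) , π₂ ⟩ ⟩  ≡⟨ cong (wk₁ ∘_) (sym assocʳ∘swap₂₃) ⟩
    wk₁ ∘ (assocʳ ∘ swap₂₃)                                            ∎

  wk₂-through-swap₂₃ : ∀ {e d x c} →
    wk₂ ≡ ((id ⊗₁ π₂) ∘ wk₂) ∘ (assocʳ ∘ swap₂₃ {e} {d} {x} {c})
  wk₂-through-swap₂₃ = sym (begin
    ((id ⊗₁ π₂) ∘ wk₂) ∘ (assocʳ ∘ swap₂₃)                              ≡⟨ assoc _ _ _ ⟩
    (id ⊗₁ π₂) ∘ (wk₂ ∘ (assocʳ ∘ swap₂₃))                              ≡⟨ cong (λ k → (id ⊗₁ π₂) ∘ (wk₂ ∘ k)) assocʳ∘swap₂₃ ⟩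
    (id ⊗₁ π₂) ∘ (wk₂ ∘ ⟨ ⟨ π₁ ∘ (π₁ ∘ π₁) , π₂ ∘ π₁ ⟩ , ⟨ π₂ ∘ (π₁ ∘ π₁) , π₂ ⟩ ⟩)
                                                                       ≡⟨ cong ((id ⊗₁ π₂) ∘_) (wk₂∘⟨⟩ _ _) ⟩
    (id ⊗₁ π₂) ∘ ⟨ π₂ ∘ ⟨ π₁ ∘ (π₁ ∘ π₁) , π₂ ∘ π₁ ⟩ , ⟨ π₂ ∘ (π₁ ∘ π₁) , π₂ ⟩ ⟩
                                                                       ≡⟨ ⊗₁∘⟨⟩ _ _ _ _ ⟩
    ⟨ id ∘ (π₂ ∘ ⟨ π₁ ∘ (π₁ ∘ π₁) , π₂ ∘ π₁ ⟩) , π₂ ∘ ⟨ π₂ ∘ (π₁ ∘ π₁) , π₂ ⟩ ⟩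
                                                                       ≡⟨ cong₂ ⟨_,_⟩ (trans (identityˡ _) (π₂-β _ _)) (π₂-β _ _) ⟩
    wk₂                                                                ∎)

  assocʳ-natural : ∀ {e d c' c} (f : Hom c' c) →
    assocʳ {e} {d} ∘ (id ⊗₁ f) ≡ (id ⊗₁ (id ⊗₁ f)) ∘ assocʳ
  assocʳ-natural f = begin
    assocʳ ∘ (id ⊗₁ f)                                   ≡⟨ assocʳ∘⟨⟩ _ _ ⟩
    ⟨ π₁ ∘ (id ∘ π₁) , ⟨ π₂ ∘ (id ∘ π₁) , f ∘ π₂ ⟩ ⟩      ≡⟨ cong₂ (λ u v → ⟨ π₁ ∘ u , ⟨ π₂ ∘ v , f ∘ π₂ ⟩ ⟩) (identityˡ _) (identityˡ _) ⟩
    ⟨ π₁ ∘ π₁ , ⟨ π₂ ∘ π₁ , f ∘ π₂ ⟩ ⟩                    ≡⟨ sym (cong₂ (λ u v → ⟨ u , ⟨ v , f ∘ π₂ ⟩ ⟩) (identityˡ _) (identityˡ _)) ⟩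
    ⟨ id ∘ (π₁ ∘ π₁) , ⟨ id ∘ (π₂ ∘ π₁) , f ∘ π₂ ⟩ ⟩      ≡⟨ cong ⟨ _ ,_⟩ (sym (⊗₁∘⟨⟩ _ _ _ _)) ⟩
    ⟨ id ∘ (π₁ ∘ π₁) , (id ⊗₁ f) ∘ ⟨ π₂ ∘ π₁ , π₂ ⟩ ⟩     ≡⟨ sym (⊗₁∘⟨⟩ _ _ _ _) ⟩
    (id ⊗₁ (id ⊗₁ f)) ∘ assocʳ                           ∎

module ExistentialCompletion {o h p ℓ} (D : Doctrine o h p ℓ) where
  open Doctrine D
  open Existential D
  open CartesianProperties 𝒞

  *-resp-≡ : ∀ {a b} {k k' : Hom a b} (x : ∣P∣ b) → k ≡ k' → PL._≈_ a ((k *) x) ((k' *) x)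
  *-resp-≡ x refl = PL.refl _

  *-square : ∀ {a b b' z} {f : Hom a b} {g : Hom b z} {f' : Hom a b'} {g' : Hom b' z} (x : ∣P∣ z) →
             g ∘ f ≡ g' ∘ f' → PL._≈_ a ((f *) ((g *) x)) ((f' *) ((g' *) x))
  *-square {f = f} {g} {f'} {g'} x gf≡g'f' =
    PL.trans _ (PL.sym _ (*-∘ g f x)) (PL.trans _ (*-resp-≡ x gf≡g'f') (*-∘ g' f' x))

  ≈⇒≤⋁[-] : ∀ {a} {x y : ∣P∣ a} → PL._≈_ a x y → PL._≤_ a x (PL.⋁ a (y ∷ []))
  ≈⇒≤⋁[-] {a} {x} {y} x≈y =
    Pa.trans (Pa.∧-cong Pa.refl (Pa.∨-cong (Pa.sym x≈y) Pa.refl)) (Pa.∧-absorbs-∨ x Pa.⊥)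
    where module Pa = PL a

  -- Σ∃, _∃* and _∧∃_ of Defs unfold definitionally to map/concatMap of these
  -- generator-level operations, which is what the pointwise lemmas below rely on.
  Σᵍ : ∀ {c} (d : Obj) → Gen (d ⊗ c) → Gen c
  Σᵍ d (e , x) = (e ⊗ d) , (assocʳ *) x

  _∃*ᵍ : ∀ {c' c} → Hom c' c → Gen c → Gen c'
  (f ∃*ᵍ) (d , x) = d , ((id ⊗₁ f) *) x

  _∧ᵍ_ : ∀ {c} → Gen c → Gen c → Gen c
  _∧ᵍ_ {c} (d , x) (e , y) = (d ⊗ e) , PL._∧_ ((d ⊗ e) ⊗ c) ((wk₁ *) x) ((wk₂ *) y)

  _◁ᵍ_ : ∀ {c} → Gen c → Gen c → Set (h ⊔ ℓ)
  _◁ᵍ_ {c} (d , x) (e , y) =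
    Σ (Hom (d ⊗ c) (e ⊗ c)) λ r → (π₂ ∘ r ≡ π₂) × PL._≈_ (d ⊗ c) x ((r *) y)

  record _≅ᵍ_ {c} (g g' : Gen c) : Set (h ⊔ ℓ) where
    field
      cover    : g ◁ᵍ g'
      inverse  : Hom (proj₁ g' ⊗ c) (proj₁ g ⊗ c)
      inverseʳ : proj₁ cover ∘ inverse ≡ id

  ≅ᵍ⇒◁ᵍ˘ : ∀ {c} {g g' : Gen c} → g ≅ᵍ g' → g' ◁ᵍ g
  ≅ᵍ⇒◁ᵍ˘ {c} {d , x} {e , y} record { cover = (r , over , x≈r*y) ; inverse = s ; inverseʳ = r∘s≡id } =
    s , over-c , y≈s*x
    where
    over-c : π₂ ∘ s ≡ π₂
    over-c = begin
      π₂ ∘ s        ≡⟨ cong (_∘ s) (sym over) ⟩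
      (π₂ ∘ r) ∘ s  ≡⟨ assoc π₂ r s ⟩
      π₂ ∘ (r ∘ s)  ≡⟨ cong (π₂ ∘_) r∘s≡id ⟩
      π₂ ∘ id       ≡⟨ identityʳ π₂ ⟩
      π₂            ∎
      where open ≡-Reasoning
    y≈s*x : PL._≈_ (e ⊗ c) y ((s *) x)
    y≈s*x = begin
      y                ≈⟨ PL.sym _ (*-id y) ⟩
      (id *) y         ≈⟨ *-resp-≡ y (sym r∘s≡id) ⟩
      ((r ∘ s) *) y    ≈⟨ *-∘ r s y ⟩
      (s *) ((r *) y)  ≈⟨ *-cong s (PL.sym _ x≈r*y) ⟩
      (s *) x          ∎
      where open SetoidReasoning (PL.setoid (e ⊗ c))

  any-◁ᵍ⇒◁ : ∀ {c} {g : Gen c} {Y : P∃ c} → Any (g ◁ᵍ_) Y → g ◁ Y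
  any-◁ᵍ⇒◁ g◁y with (r , over , x≈r*y) ← lookup-index g◁y =
    ((index g◁y , r , over) ∷ []) , ≈⇒≤⋁[-] x≈r*y

  pointwise⇒≤∃ : ∀ {c} {X Y : P∃ c} → Pointwise _◁ᵍ_ X Y → X ≤∃ Y
  pointwise⇒≤∃ X◁Y = All.map any-◁ᵍ⇒◁ (pointwise⇒all-any X◁Y)

  pointwise⇒≈∃ : ∀ {c} {X Y : P∃ c} → Pointwise _≅ᵍ_ X Y → X ≈∃ Y
  pointwise⇒≈∃ X≅Y =
    pointwise⇒≤∃ (Pointwise.map _≅ᵍ_.cover X≅Y) , pointwise⇒≤∃ (Pointwise.symmetric ≅ᵍ⇒◁ᵍ˘ X≅Y)

  frobeniusᵍ : ∀ {c d} (a : Gen (d ⊗ c)) (b : Gen c) → (Σᵍ d a ∧ᵍ b) ≅ᵍ Σᵍ d (a ∧ᵍ (π₂ ∃*ᵍ) b)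
  frobeniusᵍ {c} {d} (e , x) (e' , y) = record
    { cover    = swap₂₃ , π₂-β _ _ , lhs≈swap₂₃*rhs
    ; inverse  = swap₂₃
    ; inverseʳ = swap₂₃-involutive
    }
    where
    open PL (((e ⊗ d) ⊗ e') ⊗ c) using (_≈_; _∧_; ∧-cong)
    open SetoidReasoning (PL.setoid (((e ⊗ d) ⊗ e') ⊗ c))
    α∘swap : Hom (((e ⊗ d) ⊗ e') ⊗ c) ((e ⊗ e') ⊗ (d ⊗ c))
    α∘swap = assocʳ ∘ swap₂₃
    lhs≈swap₂₃*rhs : (wk₁ *) ((assocʳ *) x) ∧ (wk₂ *) y ≈
                     (swap₂₃ *) ((assocʳ *) (PL._∧_ _ ((wk₁ *) x) ((wk₂ *) (((id ⊗₁ π₂) *) y))))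
    lhs≈swap₂₃*rhs = begin
      (wk₁ *) ((assocʳ *) x) ∧ (wk₂ *) y
        ≈⟨ ∧-cong (*-square x assocʳ∘wk₁) (*-resp-≡ y wk₂-through-swap₂₃) ⟩
      (α∘swap *) ((wk₁ *) x) ∧ ((((id ⊗₁ π₂) ∘ wk₂) ∘ α∘swap) *) y
        ≈⟨ ∧-cong (PL.refl _) (PL.trans _ (*-∘ _ α∘swap y) (*-cong α∘swap (*-∘ (id ⊗₁ π₂) wk₂ y))) ⟩
      (α∘swap *) ((wk₁ *) x) ∧ (α∘swap *) ((wk₂ *) (((id ⊗₁ π₂) *) y))
        ≈⟨ PL.sym _ (*-∧ α∘swap _ _) ⟩
      (α∘swap *) (PL._∧_ _ ((wk₁ *) x) ((wk₂ *) (((id ⊗₁ π₂) *) y)))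
        ≈⟨ *-∘ assocʳ swap₂₃ _ ⟩
      (swap₂₃ *) ((assocʳ *) (PL._∧_ _ ((wk₁ *) x) ((wk₂ *) (((id ⊗₁ π₂) *) y))))
        ∎

  beck-chevalleyᵍ : ∀ {c' c d} (f : Hom c' c) (a : Gen (d ⊗ c)) →
                    (f ∃*ᵍ) (Σᵍ d a) ≅ᵍ Σᵍ d (((id ⊗₁ f) ∃*ᵍ) a)
  beck-chevalleyᵍ f (e , x) = record
    { cover    = id , identityʳ π₂ , PL.trans _ (*-square x (assocʳ-natural f)) (PL.sym _ (*-id _))
    ; inverse  = id
    ; inverseʳ = identityˡ id
    }

  frobenius-pointwise : ∀ {c d} (X : P∃ (d ⊗ c)) (Y : P∃ c) →
                        Pointwise _≅ᵍ_ (Σ∃ d X ∧∃ Y) (Σ∃ d (X ∧∃ (π₂ ∃*) Y))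
  frobenius-pointwise []      Y = []
  frobenius-pointwise {d = d} (a ∷ X) Y = row Y (frobenius-pointwise X Y)
    where
    row : ∀ Y' {L R} → Pointwise _≅ᵍ_ L (map (Σᵍ d) R) →
          Pointwise _≅ᵍ_ (map (Σᵍ d a ∧ᵍ_) Y' ++ L) (map (Σᵍ d) (map (a ∧ᵍ_) (map (π₂ ∃*ᵍ) Y') ++ R))
    row []       L≅R = L≅R
    row (b ∷ Y') L≅R = frobeniusᵍ a b ∷ row Y' L≅R

  beck-chevalley-pointwise : ∀ {c' c} (f : Hom c' c) (d : Obj) (X : P∃ (d ⊗ c)) →
                             Pointwise _≅ᵍ_ ((f ∃*) (Σ∃ d X)) (Σ∃ d (((id ⊗₁ f) ∃*) X))
  beck-chevalley-pointwise f d []      = []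
  beck-chevalley-pointwise f d (a ∷ X) = beck-chevalleyᵍ f a ∷ beck-chevalley-pointwise f d X

open ExistentialCompletion using (pointwise⇒≈∃; frobenius-pointwise; beck-chevalley-pointwise)

lemma4p4 : ∀ {o h p ℓ} (D : Doctrine o h p ℓ) →
    let open Doctrine D in
    let open Existential D in
    (∀ (c d : Obj) (X : P∃ (d ⊗ c)) (Y : P∃ c) →
       (Σ∃ d X ∧∃ Y) ≈∃ Σ∃ d (X ∧∃ (π₂ ∃*) Y))
    ×
    (∀ {c' c : Obj} (f : Hom c' c) (d : Obj) (X : P∃ (d ⊗ c)) →
       (f ∃*) (Σ∃ d X) ≈∃ Σ∃ d (((id ⊗₁ f) ∃*) X))
lemma4p4 D =
  (λ c d X Y → pointwise⇒≈∃ D (frobenius-pointwise D X Y)) ,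
  (λ f d X → pointwise⇒≈∃ D (beck-chevalley-pointwise D f d X))
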